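{- Let $N\ge 2$, let $A_1,A_2,\ldots$ be a quasifibonacci sequence of level $N$, and let $n\ge1$ with $S_n\neq\emptyset$. Then the poset $P_n$ has a unique minimal element $\hat 0$; moreover $\hat 0$ is the unique element $a\in S_n$ whose reduced representation $(a_1,\ldots,a_{l(a)})$ does not contain $N$ consecutive $0$'s (i.e. there is no $j$ with $1\le j$, $j+N-1\le l(a)$ and $a_j=\cdots=a_{j+N-1}=0$).
   Context: For an integer $N\ge 2$, a sequence $A_1,A_2,\ldots$ of positive integers is a quasifibonacci sequence of level $N$ if $A_{k+N}=A_{k+N-1}+\cdots+A_k$ for all $k\ge 1$, and $A_k>A_{k-1}+\cdots+A_1$ for all $1\le k\le N$. Let $\{0,1\}^{\omega}$ be the set of sequences $(a_1,a_2,\ldots)$ with $a_i\in\{0,1\}$ and $a_i=0$ for all but finitely many $i$. For $n\ge0$, $S_n=\{a\in\{0,1\}^{\omega}:\sum_{i}a_iA_i=n\}$. For nonzero $a$, $l(a)$ is the largest $i$ with $a_i=1$, and $(a_1,\ldots,a_{l(a)})$ is its reduced representation. The digraph $G_n$ has vertex set $S_n$, with a directed edge $a\to b$ iff there is $j\ge1$ such that $a_{j+N}=1$, $a_j=\cdots=a_{j+N-1}=0$, $b_{j+N}=0$, $b_j=\cdots=b_{j+N-1}=1$, and $a_t=b_t$ for all $t\notin\{j,\ldots,j+N\}$. The poset $P_n$ is $S_n$ ordered by $a\ge b$ iff there is a directed path in $G_n$ from $a$ to $b$. -}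

module Defs where

open import Data.Nat using (ℕ; zero; suc; _+_; _∸_; _≤_; _<_)
open import Data.Bool using (Bool; true; false; if_then_else_)
open import Data.Product using (Σ; ∃; _×_; _,_)
open import Data.Sum using (_⊎_)
open import Data.Empty using (⊥)
open import Relation.Binary.PropositionalEquality using (_≡_; _≗_)
open import Relation.Binary.Construct.Closure.ReflexiveTransitive using (Star)

-- All sequences are functions ℕ → _, indexed from 1 as in the paper;
-- index 0 is a dummy position (ignored for A, forced to be false for a).

rangeSum : (ℕ → ℕ) → ℕ → ℕ → ℕ
rangeSum f lo zero    = 0
rangeSum f lo (suc l) = f lo + rangeSum f (suc lo) l

record Quasifibonacci (N : ℕ) (A : ℕ → ℕ) : Set where
  field
    positive   : ∀ k → 1 ≤ k → 0 < A k
    recurrence : ∀ k → 1 ≤ k → A (k + N) ≡ rangeSum A k N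
    initial    : ∀ k → 1 ≤ k → k ≤ N → rangeSum A 1 (k ∸ 1) < A k

weight : (ℕ → ℕ) → (ℕ → Bool) → ℕ → ℕ
weight A a B = rangeSum (λ i → if a i then A i else 0) 1 B

InS : (ℕ → ℕ) → ℕ → (ℕ → Bool) → Set
InS A n a = (a 0 ≡ false) ×
  ∃ λ B → (∀ i → B < i → a i ≡ false) × weight A a B ≡ n

Edge : ℕ → (ℕ → Bool) → (ℕ → Bool) → Set
Edge N a b = ∃ λ j → 1 ≤ j ×
  (a (j + N) ≡ true) × (∀ i → i < N → a (j + i) ≡ false) ×
  (b (j + N) ≡ false) × (∀ i → i < N → b (j + i) ≡ true) ×
  (∀ t → (t < j ⊎ j + N < t) → a t ≡ b t)

Geq : ℕ → (ℕ → Bool) → (ℕ → Bool) → Set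
Geq N = Star (Edge N)

Minimal : ℕ → (ℕ → ℕ) → ℕ → (ℕ → Bool) → Set
Minimal N A n a = InS A n a × (∀ b → InS A n b → Geq N a b → a ≗ b)

-- the reduced representation of a has no N consecutive zeros:
-- there is no j ≥ 1 with j+N-1 ≤ l(a) and a_j = ... = a_{j+N-1} = 0.
-- (j + N - 1 ≤ l(a) is written as: some m ≥ j + N - 1 has a_m = 1.)
NoNZeros : ℕ → (ℕ → Bool) → Set
NoNZeros N a = ∀ j → 1 ≤ j → (∃ λ m → j + N ∸ 1 ≤ m × a m ≡ true) →
  (∀ i → i < N → a (j + i) ≡ false) → ⊥

-- Call a representation a ∈ S_n lazy if its reduced form contains no N
-- consecutive zeros.  The proof rests on three facts about lazy sequences.
--
--  * Lower bound: if a is lazy and a_{l+1} = 1 then A_1 + … + A_l is smaller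
--    than the weight of a_1 … a_{l+1}.  For l < N this is the initial
--    condition; otherwise the last 1 of the window just below l+1 reduces it
--    to a smaller l, using A_{j+N} = A_j + … + A_{j+N-1}.
--  * Uniqueness: the lower bound forces two lazy sequences of equal weight
--    to agree digit by digit from the top down.
--  * Existence: every prefix a_1 … a_B has a lazy sequence of the same weight,
--    built by induction on B; when the new top digit completes a zero block,
--    an edge move pushes it down into the block and the shorter prefix is
--    re-normalised.
--
-- An edge move preserves the weight, so a non-lazy sequence is never minimal
-- (move its first 1 after a zero block), while a lazy one has no outgoing edge
-- at all.  Hence the minimal elements of P_n are exactly the lazy ones, and
-- there is exactly one of them.

module Submission where

open import Defs
open import Data.Nat using (ℕ; zero; suc; _+_; _∸_; _≤_; _<_; z≤n; s≤s; s≤s⁻¹; z<s; _≟_; _≤?_; _<?_)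
open import Data.Nat.Properties
open import Data.Nat.Induction using (<-rec)
open import Data.Bool using (Bool; true; false; if_then_else_)
open import Data.Product using (∃; _×_; _,_; proj₁; proj₂)
open import Data.Sum using (_⊎_; inj₁; inj₂; [_,_]′)
open import Data.Empty using (⊥; ⊥-elim)
open import Relation.Nullary using (¬_; Dec; yes; no)
open import Relation.Binary.PropositionalEquality
open import Relation.Binary.Construct.Closure.ReflexiveTransitive using (ε; _◅_)

rangeSum-split : ∀ f lo x y →
  rangeSum f lo (x + y) ≡ rangeSum f lo x + rangeSum f (lo + x) y
rangeSum-split f lo zero    y rewrite +-identityʳ lo = refl
rangeSum-split f lo (suc x) y rewrite rangeSum-split f (suc lo) x y | +-suc lo x =
  sym (+-assoc (f lo) _ _)

rangeSum-cong : ∀ f g lo len → (∀ i → lo ≤ i → i < lo + len → f i ≡ g i) →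
  rangeSum f lo len ≡ rangeSum g lo len
rangeSum-cong f g lo zero      h = refl
rangeSum-cong f g lo (suc len) h =
  cong₂ _+_ (h lo ≤-refl (m<m+n lo z<s))
    (rangeSum-cong f g (suc lo) len
      (λ i lo<i i< → h i (<⇒≤ lo<i) (subst (i <_) (sym (+-suc lo len)) i<)))

rangeSum-zero : ∀ f lo len → (∀ i → lo ≤ i → i < lo + len → f i ≡ 0) →
  rangeSum f lo len ≡ 0
rangeSum-zero f lo len h = trans (rangeSum-cong f (λ _ → 0) lo len h) (constZero lo len)
  where
  constZero : ∀ lo len → rangeSum (λ _ → 0) lo len ≡ 0
  constZero lo zero      = refl
  constZero lo (suc len) = constZero (suc lo) len

rangeSum-snoc : ∀ f lo k → rangeSum f lo (suc k) ≡ rangeSum f lo k + f (lo + k)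
rangeSum-snoc f lo k = begin
  rangeSum f lo (suc k)              ≡⟨ cong (rangeSum f lo) (+-comm 1 k) ⟩
  rangeSum f lo (k + 1)              ≡⟨ rangeSum-split f lo k 1 ⟩
  rangeSum f lo k + (f (lo + k) + 0) ≡⟨ cong (rangeSum f lo k +_) (+-identityʳ _) ⟩
  rangeSum f lo k + f (lo + k)       ∎
  where open ≡-Reasoning

rangeSum-mono : ∀ f g lo len → (∀ i → f i ≤ g i) → rangeSum f lo len ≤ rangeSum g lo len
rangeSum-mono f g lo zero      h = z≤n
rangeSum-mono f g lo (suc len) h = +-mono-≤ (h lo) (rangeSum-mono f g (suc lo) len h)

true≢false : true ≡ false → ⊥
true≢false ()

Block : (ℕ → Bool) → ℕ → ℕ → Bool → Set
Block f lo len v = ∀ i → i < len → f (lo + i) ≡ v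

block-at : ∀ {f lo len v x} → Block f lo len v → lo ≤ x → x < lo + len → f x ≡ v
block-at {f} {lo} {len} {v} {x} blk lo≤x x< =
  subst (λ y → f y ≡ v) (m+[n∸m]≡n lo≤x)
    (blk (x ∸ lo) (+-cancelˡ-< lo _ _ (subst (_< lo + len) (sym (m+[n∸m]≡n lo≤x)) x<)))

pastZeroBlock : ∀ {f lo len m} → Block f lo len false → f m ≡ true → lo ≤ m → lo + len ≤ m
pastZeroBlock {f} {lo} {len} {m} zeros fm lo≤m with m <? lo + len
... | yes m< = ⊥-elim (true≢false (trans (sym fm) (block-at {f} zeros lo≤m m<)))
... | no  m≮ = ≮⇒≥ m≮

VanishesAbove : (ℕ → Bool) → ℕ → Set
VanishesAbove f B = ∀ i → B < i → f i ≡ false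

vanishes-suc : ∀ {f B} → VanishesAbove f B → VanishesAbove f (suc B)
vanishes-suc {B = B} fS i B<i = fS i (<-trans (n<1+n B) B<i)

withinSupport : ∀ {f B i} → VanishesAbove f B → f i ≡ true → i ≤ B
withinSupport {B = B} {i} fS fi with i ≤? B
... | yes i≤B = i≤B
... | no  i≰B = ⊥-elim (true≢false (trans (sym fi) (fS i (≰⇒> i≰B))))

<+suc⇒≤ : ∀ {t} lo len → t < lo + suc len → t ≤ lo + len
<+suc⇒≤ {t} lo len t< = s≤s⁻¹ (subst (t <_) (+-suc lo len) t<)

lastOne : (f : ℕ → Bool) (lo len : ℕ) → Block f lo len false ⊎
  ∃ λ k → lo ≤ k × k < lo + len × f k ≡ true × (∀ t → k < t → t < lo + len → f t ≡ false)
lastOne f lo zero = inj₁ (λ _ ())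
lastOne f lo (suc len) with f (lo + len) in top | lastOne f lo len
... | true  | _ =
  inj₂ (lo + len , m≤m+n lo len , +-monoʳ-< lo (n<1+n len) , top ,
        λ t k<t t< → ⊥-elim (<⇒≱ k<t (<+suc⇒≤ lo len t<)))
... | false | inj₁ zeros =
  inj₁ λ i i< → [ zeros i , (λ i≡ → subst (λ x → f (lo + x) ≡ false) (sym i≡) top) ]′
                  (m<1+n⇒m<n∨m≡n i<)
... | false | inj₂ (k , lo≤k , k< , fk , after) =
  inj₂ (k , lo≤k , <-trans k< (+-monoʳ-< lo (n<1+n len)) , fk ,
        λ t k<t t< → [ after t k<t , (λ t≡ → subst (λ x → f x ≡ false) (sym t≡) top) ]′
                       (m≤n⇒m<n∨m≡n (<+suc⇒≤ lo len t<)))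

firstOne : (f : ℕ → Bool) (lo d : ℕ) → f (lo + d) ≡ true →
  ∃ λ m → lo ≤ m × f m ≡ true × (∀ t → lo ≤ t → t < m → f t ≡ false)
firstOne f lo zero h =
  lo , ≤-refl , subst (λ x → f x ≡ true) (+-identityʳ lo) h ,
  λ t lo≤t t<lo → ⊥-elim (<⇒≱ t<lo lo≤t)
firstOne f lo (suc d) h with f lo in start
... | true  = lo , ≤-refl , start , λ t lo≤t t<lo → ⊥-elim (<⇒≱ t<lo lo≤t)
... | false with firstOne f (suc lo) d (subst (λ x → f x ≡ true) (+-suc lo d) h)
...   | m , lo<m , fm , before =
  m , <⇒≤ lo<m , fm ,
  λ t lo≤t t<m → [ (λ lo<t → before t lo<t t<m) ,
                   (λ lo≡t → subst (λ x → f x ≡ false) lo≡t start) ]′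
                   (m≤n⇒m<n∨m≡n lo≤t)

update : (ℕ → Bool) → ℕ → Bool → ℕ → Bool
update f k v i with i ≟ k
... | yes _ = v
... | no  _ = f i

update-at : ∀ f k v → update f k v k ≡ v
update-at f k v with k ≟ k
... | yes _   = refl
... | no  k≢k = ⊥-elim (k≢k refl)

update-other : ∀ f k v {i} → ¬ i ≡ k → update f k v i ≡ f i
update-other f k v {i} i≢k with i ≟ k
... | yes i≡k = ⊥-elim (i≢k i≡k)
... | no  _   = refl

fillBlock : (ℕ → Bool) → ℕ → ℕ → ℕ → Bool
fillBlock f lo len i with lo ≤? i | i <? lo + len
... | yes _ | yes _ = true
... | _     | _     = f i

fillBlock-inside : ∀ f lo len {i} → lo ≤ i → i < lo + len → fillBlock f lo len i ≡ true
fillBlock-inside f lo len {i} lo≤i i< with lo ≤? i | i <? lo + len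
... | yes _  | yes _  = refl
... | yes _  | no i≮ = ⊥-elim (i≮ i<)
... | no lo≰ | _      = ⊥-elim (lo≰ lo≤i)

fillBlock-outside : ∀ f lo len {i} → i < lo ⊎ lo + len ≤ i → fillBlock f lo len i ≡ f i
fillBlock-outside f lo len {i} out with lo ≤? i | i <? lo + len
... | yes lo≤i | yes i< = ⊥-elim ([ (λ i<lo → <⇒≱ i<lo lo≤i) , (λ end≤i → <⇒≱ i< end≤i) ]′ out)
... | yes _    | no _   = refl
... | no _     | _      = refl

raise : (ℕ → Bool) → ℕ → ℕ → Bool
raise c B = update c (suc B) true

raise-top : ∀ c B → raise c B (suc B) ≡ true
raise-top c B = update-at c (suc B) true

raise-below : ∀ c {B i} → i ≤ B → raise c B i ≡ c i
raise-below c {B} i≤B = update-other c (suc B) true (<⇒≢ (s≤s i≤B))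

raise-vanishes : ∀ {c B} → VanishesAbove c B → VanishesAbove (raise c B) (suc B)
raise-vanishes {c} {B} cS i sB<i = trans (update-other c (suc B) true (>⇒≢ sB<i)) (vanishes-suc cS i sB<i)

raise-zeros : ∀ c B {lo len} → Block (raise c B) lo len false → Block c lo len false
raise-zeros c B {lo} zeros i i< = decide (lo + i ≟ suc B)
  where
  decide : Dec (lo + i ≡ suc B) → c (lo + i) ≡ false
  decide (yes x≡) = ⊥-elim (true≢false
    (trans (sym (subst (λ y → raise c B y ≡ true) (sym x≡) (raise-top c B))) (zeros i i<)))
  decide (no x≢) = trans (sym (update-other c (suc B) true x≢)) (zeros i i<)

module LazyRepresentations (N : ℕ) (N≥1 : 1 ≤ N) (A : ℕ → ℕ) (q : Quasifibonacci N A) where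
  open Quasifibonacci q using (recurrence; initial)

  Lazy : (ℕ → Bool) → Set
  Lazy = NoNZeros N

  digit : (ℕ → Bool) → ℕ → ℕ
  digit a i = if a i then A i else 0

  W : (ℕ → Bool) → ℕ → ℕ
  W = weight A

  total : ℕ → ℕ
  total = rangeSum A 1

  digit-true : ∀ a {i} → a i ≡ true → digit a i ≡ A i
  digit-true a {i} e = cong (λ x → if x then A i else 0) e

  digit-false : ∀ a {i} → a i ≡ false → digit a i ≡ 0
  digit-false a {i} e = cong (λ x → if x then A i else 0) e

  digit-cong : ∀ a b {i} → a i ≡ b i → digit a i ≡ digit b i
  digit-cong a b {i} e = cong (λ x → if x then A i else 0) e

  weight≤total : ∀ a B → W a B ≤ total B
  weight≤total a B = rangeSum-mono (digit a) A 1 B digit≤A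
    where
    digit≤A : ∀ i → digit a i ≤ A i
    digit≤A i with a i
    ... | true  = ≤-refl
    ... | false = z≤n

  weight-snoc : ∀ a B → W a (suc B) ≡ W a B + digit a (suc B)
  weight-snoc a B = rangeSum-snoc (digit a) 1 B

  weight-true : ∀ a B → a (suc B) ≡ true → W a (suc B) ≡ W a B + A (suc B)
  weight-true a B e = trans (weight-snoc a B) (cong (W a B +_) (digit-true a e))

  weight-false : ∀ a B → a (suc B) ≡ false → W a (suc B) ≡ W a B
  weight-false a B e =
    trans (weight-snoc a B) (trans (cong (W a B +_) (digit-false a e)) (+-identityʳ _))

  weight-cong : ∀ {a b} B → (∀ i → 1 ≤ i → i ≤ B → a i ≡ b i) → W a B ≡ W b B
  weight-cong {a} {b} B h =
    rangeSum-cong (digit a) (digit b) 1 B (λ i 1≤i i< → digit-cong a b (h i 1≤i (s≤s⁻¹ i<)))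

  weight-skip : ∀ a B k → (∀ i → B < i → i ≤ B + k → a i ≡ false) → W a (B + k) ≡ W a B
  weight-skip a B k zeros =
    trans (rangeSum-split (digit a) 1 B k)
      (trans (cong (W a B +_) (rangeSum-zero (digit a) (suc B) k
                (λ i B<i i< → digit-false a (zeros i B<i (s≤s⁻¹ i<)))))
             (+-identityʳ _))

  weight-stable : ∀ {a B C} → VanishesAbove a B → B ≤ C → W a C ≡ W a B
  weight-stable {a} {B} aS B≤C with m≤n⇒∃[o]m+o≡n B≤C
  ... | k , refl = weight-skip a B k (λ i B<i _ → aS i B<i)

  move : (ℕ → Bool) → ℕ → ℕ → Bool
  move a j = update (fillBlock a j N) (j + N) false

  move-top : ∀ a j → move a j (j + N) ≡ false
  move-top a j = update-at (fillBlock a j N) (j + N) false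

  move-outside : ∀ a j t → t < j ⊎ j + N < t → move a j t ≡ a t
  move-outside a j t out =
    trans (update-other (fillBlock a j N) (j + N) false (t≢top out))
          (fillBlock-outside a j N ([ inj₁ , (λ lt → inj₂ (<⇒≤ lt)) ]′ out))
    where
    t≢top : t < j ⊎ j + N < t → ¬ t ≡ j + N
    t≢top (inj₁ t<j) = <⇒≢ (<-≤-trans t<j (m≤m+n j N))
    t≢top (inj₂ lt)  = >⇒≢ lt

  moveEdge : ∀ a j → 1 ≤ j → a (j + N) ≡ true → Block a j N false → Edge N a (move a j)
  moveEdge a j 1≤j top zeros =
    j , 1≤j , top , zeros , move-top a j , ones , λ t out → sym (move-outside a j t out)
    where
    ones : Block (move a j) j N true
    ones i i<N =
      trans (update-other (fillBlock a j N) (j + N) false (<⇒≢ (+-monoʳ-< j i<N)))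
            (fillBlock-inside a j N (m≤m+n j i) (+-monoʳ-< j i<N))

  -- An edge move at j preserves the weight of every prefix containing the move:
  -- A_{j+N} = A_j + … + A_{j+N-1} is exactly the defining recurrence.
  edgeWeight : ∀ {a b B} (e : Edge N a b) → proj₁ e + N ≤ B → W a B ≡ W b B
  edgeWeight (zero , () , _) _
  edgeWeight {a} {b} (suc j0 , _ , aTop , aZeros , bTop , bOnes , same) le
    with m≤n⇒∃[o]m+o≡n le
  ... | k , refl = trans aSide (sym bSide)
    where
    open ≡-Reasoning

    S : ℕ
    S = rangeSum A (suc j0) N

    tail : (ℕ → Bool) → ℕ
    tail x = rangeSum (digit x) (suc (suc j0 + N)) k

    decompose : ∀ x → W x (suc j0 + N + k) ≡
      W x j0 + rangeSum (digit x) (suc j0) N + digit x (suc j0 + N) + tail x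
    decompose x = begin
      W x (suc j0 + N + k)                          ≡⟨ rangeSum-split (digit x) 1 (suc j0 + N) k ⟩
      W x (suc j0 + N) + tail x                     ≡⟨ cong (_+ tail x) (weight-snoc x (j0 + N)) ⟩
      W x (j0 + N) + digit x (suc j0 + N) + tail x
        ≡⟨ cong (λ s → s + digit x (suc j0 + N) + tail x) (rangeSum-split (digit x) 1 j0 N) ⟩
      W x j0 + rangeSum (digit x) (suc j0) N + digit x (suc j0 + N) + tail x ∎

    prefix : W a j0 ≡ W b j0
    prefix = weight-cong j0 (λ i _ i≤j0 → same i (inj₁ (s≤s i≤j0)))

    aBlock : rangeSum (digit a) (suc j0) N ≡ 0
    aBlock = rangeSum-zero (digit a) (suc j0) N
      (λ i lo≤i i< → digit-false a (block-at {a} aZeros lo≤i i<))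

    aMoved : digit a (suc j0 + N) ≡ S
    aMoved = trans (digit-true a aTop) (recurrence (suc j0) z<s)

    bBlock : rangeSum (digit b) (suc j0) N ≡ S
    bBlock = rangeSum-cong (digit b) A (suc j0) N
      (λ i lo≤i i< → digit-true b (block-at {b} bOnes lo≤i i<))

    tails : tail a ≡ tail b
    tails = rangeSum-cong (digit a) (digit b) (suc (suc j0 + N)) k
      (λ i lt _ → digit-cong a b (same i (inj₂ lt)))

    aSide : W a (suc j0 + N + k) ≡ W b j0 + S + tail b
    aSide = begin
      W a (suc j0 + N + k)       ≡⟨ decompose a ⟩
      W a j0 + rangeSum (digit a) (suc j0) N + digit a (suc j0 + N) + tail a
        ≡⟨ cong₂ _+_ (cong₂ _+_ (cong₂ _+_ prefix aBlock) aMoved) tails ⟩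
      W b j0 + 0 + S + tail b    ≡⟨ cong (λ s → s + S + tail b) (+-identityʳ (W b j0)) ⟩
      W b j0 + S + tail b        ∎

    bSide : W b (suc j0 + N + k) ≡ W b j0 + S + tail b
    bSide = begin
      W b (suc j0 + N + k)       ≡⟨ decompose b ⟩
      W b j0 + rangeSum (digit b) (suc j0) N + digit b (suc j0 + N) + tail b
        ≡⟨ cong₂ (λ u v → W b j0 + u + v + tail b) bBlock (digit-false b bTop) ⟩
      W b j0 + S + 0 + tail b    ≡⟨ cong (_+ tail b) (+-identityʳ (W b j0 + S)) ⟩
      W b j0 + S + tail b        ∎

  beyondInitial : ∀ {l} → ¬ suc l ≤ N → ∃ λ j0 → j0 + N ≡ l
  beyondInitial sl≰N with m≤n⇒∃[o]m+o≡n (s≤s⁻¹ (≰⇒> sl≰N))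
  ... | j0 , N+j0≡l = j0 , trans (+-comm j0 N) N+j0≡l

  -- The last N terms below A_{j0+N+1} sum to A_{j0+N+1}, so any final stretch
  -- of them is at most A_{j0+N+1}.
  window≤next : ∀ j0 x y → x + y ≡ N → rangeSum A (suc j0 + x) y ≤ A (suc j0 + N)
  window≤next j0 x y x+y≡N = begin
    rangeSum A (suc j0 + x) y                          ≤⟨ m≤n+m _ _ ⟩
    rangeSum A (suc j0) x + rangeSum A (suc j0 + x) y  ≡⟨ sym (rangeSum-split A (suc j0) x y) ⟩
    rangeSum A (suc j0) (x + y)                        ≡⟨ cong (rangeSum A (suc j0)) x+y≡N ⟩
    rangeSum A (suc j0) N                              ≡⟨ sym (recurrence (suc j0) z<s) ⟩
    A (suc j0 + N)                                     ∎
    where open ≤-Reasoning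

  -- Inductive step of the lower bound: the last 1 of a below the top digit
  -- j0+N+1 sits at j0+x+1 with x < N; the positions after it up to j0+N weigh
  -- at most A_{j0+N+1}.
  windowBound : ∀ {a} j0 x → x < N → a (suc (j0 + N)) ≡ true →
    (∀ t → suc j0 + x < t → t < suc j0 + N → a t ≡ false) →
    total (j0 + x) < W a (suc (j0 + x)) → total (j0 + N) < W a (suc (j0 + N))
  windowBound {a} j0 x x<N top after below with m≤n⇒∃[o]m+o≡n x<N
  ... | y , sx+y≡N = begin-strict
    total (j0 + N)                                      ≡⟨ totalSplit ⟩
    total (j0 + x) + rangeSum A (suc (j0 + x)) (suc y)
      <⟨ +-mono-<-≤ below (window≤next j0 x (suc y) x+sy≡N) ⟩
    W a (suc (j0 + x)) + A (suc (j0 + N))               ≡⟨ cong (_+ A (suc (j0 + N))) (sym flat) ⟩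
    W a (j0 + N) + A (suc (j0 + N))                     ≡⟨ sym (weight-true a (j0 + N) top) ⟩
    W a (suc (j0 + N))                                  ∎
    where
    open ≤-Reasoning
    x+sy≡N : x + suc y ≡ N
    x+sy≡N = trans (+-suc x y) sx+y≡N

    end≡ : j0 + N ≡ j0 + x + suc y
    end≡ = trans (cong (j0 +_) (sym x+sy≡N)) (sym (+-assoc j0 x (suc y)))

    totalSplit : total (j0 + N) ≡ total (j0 + x) + rangeSum A (suc (j0 + x)) (suc y)
    totalSplit = trans (cong total end≡) (rangeSum-split A 1 (j0 + x) (suc y))

    end≡′ : j0 + N ≡ suc (j0 + x) + y
    end≡′ = trans end≡ (+-suc (j0 + x) y)

    flat : W a (j0 + N) ≡ W a (suc (j0 + x))
    flat = trans (cong (W a) end≡′) (weight-skip a (suc (j0 + x)) y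
      (λ i lt i≤ → after i lt (s≤s (subst (i ≤_) (sym end≡′) i≤))))

  lazyLowerBound : ∀ l {a} → Lazy a → a (suc l) ≡ true → total l < W a (suc l)
  lazyLowerBound = <-rec LowerBound bound
    where
    LowerBound : ℕ → Set
    LowerBound l = ∀ {a} → Lazy a → a (suc l) ≡ true → total l < W a (suc l)

    bound : ∀ l → (∀ {m} → m < l → LowerBound m) → LowerBound l
    bound l ih {a} la top with suc l ≤? N
    ... | yes sl≤N = begin-strict
      total l            <⟨ initial (suc l) z<s sl≤N ⟩
      A (suc l)          ≤⟨ m≤n+m (A (suc l)) (W a l) ⟩
      W a l + A (suc l)  ≡⟨ sym (weight-true a l top) ⟩
      W a (suc l)        ∎
      where open ≤-Reasoning
    ... | no sl≰N with beyondInitial sl≰N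
    ...   | j0 , refl with lastOne a (suc j0) N
    ...     | inj₁ zeros = ⊥-elim (la (suc j0) z<s (suc (j0 + N) , n≤1+n _ , top) zeros)
    ...     | inj₂ (k , sj0≤k , k<end , ak , after) with m≤n⇒∃[o]m+o≡n sj0≤k
    ...       | x , refl = windowBound j0 x x<N top after (ih (+-monoʳ-< j0 x<N) la ak)
      where
      x<N : x < N
      x<N = +-cancelˡ-< (suc j0) x N k<end

  lazyTopWins : ∀ {a b} l → Lazy a → a (suc l) ≡ true → b (suc l) ≡ false →
    W b (suc l) < W a (suc l)
  lazyTopWins {a} {b} l la aTop bTop = begin-strict
    W b (suc l)  ≡⟨ weight-false b l bTop ⟩
    W b l        ≤⟨ weight≤total b l ⟩
    total l      <⟨ lazyLowerBound l la aTop ⟩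
    W a (suc l)  ∎
    where open ≤-Reasoning

  lazyTopAgrees : ∀ {a b} l → Lazy a → Lazy b → W a (suc l) ≡ W b (suc l) →
    a (suc l) ≡ b (suc l)
  lazyTopAgrees {a} {b} l la lb eq with a (suc l) in aTop | b (suc l) in bTop
  ... | true  | true  = refl
  ... | false | false = refl
  ... | true  | false = ⊥-elim (<⇒≢ (lazyTopWins l la aTop bTop) (sym eq))
  ... | false | true  = ⊥-elim (<⇒≢ (lazyTopWins l lb bTop aTop) eq)

  lazyPrefixAgree : ∀ B {a b} → Lazy a → Lazy b → W a B ≡ W b B →
    ∀ i → 1 ≤ i → i ≤ B → a i ≡ b i
  lazyPrefixAgree zero    la lb eq i 1≤i i≤0 = ⊥-elim (<⇒≱ 1≤i i≤0)
  lazyPrefixAgree (suc B) {a} {b} la lb eq i 1≤i i≤ =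
    [ (λ i<sB → lazyPrefixAgree B la lb lowerEq i 1≤i (s≤s⁻¹ i<sB)) ,
      (λ i≡ → subst (λ x → a x ≡ b x) (sym i≡) topEq) ]′ (m≤n⇒m<n∨m≡n i≤)
    where
    open ≡-Reasoning
    topEq : a (suc B) ≡ b (suc B)
    topEq = lazyTopAgrees B la lb eq

    lowerEq : W a B ≡ W b B
    lowerEq = +-cancelʳ-≡ (digit a (suc B)) (W a B) (W b B) (begin
      W a B + digit a (suc B)  ≡⟨ sym (weight-snoc a B) ⟩
      W a (suc B)              ≡⟨ eq ⟩
      W b (suc B)              ≡⟨ weight-snoc b B ⟩
      W b B + digit b (suc B)  ≡⟨ cong (W b B +_) (digit-cong b a (sym topEq)) ⟩
      W b B + digit a (suc B)  ∎)

  lazyUnique : ∀ {n a b} → Lazy a → Lazy b → InS A n a → InS A n b → a ≗ b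
  lazyUnique {n} {a} {b} la lb (a0 , Ba , aS , aW) (b0 , Bb , bS , bW) = agree
    where
    open ≡-Reasoning
    C : ℕ
    C = Ba + Bb

    sameWeight : W a C ≡ W b C
    sameWeight = begin
      W a C   ≡⟨ weight-stable aS (m≤m+n Ba Bb) ⟩
      W a Ba  ≡⟨ aW ⟩
      n       ≡⟨ sym bW ⟩
      W b Bb  ≡⟨ sym (weight-stable bS (m≤n+m Bb Ba)) ⟩
      W b C   ∎

    agree : ∀ i → a i ≡ b i
    agree zero = trans a0 (sym b0)
    agree (suc i) with suc i ≤? C
    ... | yes i≤C = lazyPrefixAgree C la lb sameWeight (suc i) z<s i≤C
    ... | no  i≰C = trans (aS _ (≤-<-trans (m≤m+n Ba Bb) (≰⇒> i≰C)))
                          (sym (bS _ (≤-<-trans (m≤n+m Bb Ba) (≰⇒> i≰C))))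

  LazyPrefix : ℕ → (ℕ → Bool) → Set
  LazyPrefix B a = ∃ λ c → Lazy c × c 0 ≡ false × VanishesAbove c B × W c B ≡ W a B

  start≤ : ∀ {j m} → j + N ∸ 1 ≤ m → j ≤ m
  start≤ {j} {m} le = ≤-trans (m≤m+n j (N ∸ 1)) (subst (_≤ m) (+-∸-assoc j N≥1) le)

  raiseLazy : ∀ c B → Lazy c → (suc B ≤ N ⊎ ∃ λ p → c p ≡ true × suc B ≤ p + N) →
    Lazy (raise c B)
  raiseLazy c B lc room j 1≤j (m , m≥ , dm) dZeros = decide (m ≟ suc B)
    where
    cZeros : Block c j N false
    cZeros = raise-zeros c B dZeros

    end≤m : j + N ≤ m
    end≤m = pastZeroBlock {raise c B} dZeros dm (start≤ m≥)

    blocked : j + N ≤ suc B → (suc B ≤ N ⊎ ∃ λ p → c p ≡ true × suc B ≤ p + N) → ⊥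
    blocked end≤ (inj₁ sB≤N) = <⇒≱ 1≤j (+-cancelʳ-≤ N j 0 (≤-trans end≤ sB≤N))
    blocked end≤ (inj₂ (p , cp , sB≤p+N)) =
      lc j 1≤j (p , ≤-trans (m∸n≤m (j + N) 1) (pastZeroBlock {c} cZeros cp j≤p) , cp) cZeros
      where
      j≤p : j ≤ p
      j≤p = +-cancelʳ-≤ N j p (≤-trans end≤ sB≤p+N)

    decide : Dec (m ≡ suc B) → ⊥
    decide (yes m≡) = blocked (subst (j + N ≤_) m≡ end≤m) room
    decide (no  m≢) = lc j 1≤j (m , m≥ , trans (sym (update-other c (suc B) true m≢)) dm) cZeros

  raiseOrBlock : ∀ c B → Lazy c →
    Lazy (raise c B) ⊎ ∃ λ j0 → j0 + N ≡ B × Block (raise c B) (suc j0) N false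
  raiseOrBlock c B lc with suc B ≤? N
  ... | yes sB≤N = inj₁ (raiseLazy c B lc (inj₁ sB≤N))
  ... | no  sB≰N with beyondInitial sB≰N
  ...   | j0 , refl with lastOne c (suc j0) N
  ...     | inj₂ (k , sj0≤k , _ , ck , _) =
    inj₁ (raiseLazy c (j0 + N) lc (inj₂ (k , ck , +-monoˡ-≤ N sj0≤k)))
  ...     | inj₁ zeros =
    inj₂ (j0 , refl , λ i i<N → trans (raise-below c (+-monoʳ-< j0 i<N)) (zeros i i<N))

  raisePrefixWeight : ∀ {a} c B → W c B ≡ W a B → a (suc B) ≡ true →
    W (raise c B) (suc B) ≡ W a (suc B)
  raisePrefixWeight {a} c B cW aTop = begin
    W (raise c B) (suc B)  ≡⟨ weight-true (raise c B) B (raise-top c B) ⟩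
    W (raise c B) B + A (suc B)
      ≡⟨ cong (_+ A (suc B)) (weight-cong B (λ i _ i≤B → raise-below c i≤B)) ⟩
    W c B + A (suc B)      ≡⟨ cong (_+ A (suc B)) cW ⟩
    W a B + A (suc B)      ≡⟨ sym (weight-true a B aTop) ⟩
    W a (suc B)            ∎
    where open ≡-Reasoning

  afterMove : ∀ {d f} j0 → d (suc j0 + N) ≡ true → Block d (suc j0) N false →
    VanishesAbove f (j0 + N) → W f (j0 + N) ≡ W (move d (suc j0)) (j0 + N) →
    W f (suc (j0 + N)) ≡ W d (suc (j0 + N))
  afterMove {d} {f} j0 dTop zeros fS fW = begin
    W f (suc (j0 + N))  ≡⟨ weight-false f (j0 + N) (fS _ (n<1+n _)) ⟩
    W f (j0 + N)        ≡⟨ fW ⟩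
    W e (j0 + N)        ≡⟨ sym (weight-false e (j0 + N) (move-top d (suc j0))) ⟩
    W e (suc (j0 + N))  ≡⟨ sym (edgeWeight (moveEdge d (suc j0) z<s dTop zeros) ≤-refl) ⟩
    W d (suc (j0 + N))  ∎
    where
    open ≡-Reasoning
    e : ℕ → Bool
    e = move d (suc j0)

  -- Inductive step: a zero top digit changes nothing; a one is raised, and if
  -- that completes a zero block it is moved down and the prefix re-normalised.
  extendLazyPrefix : ∀ B → (∀ a → LazyPrefix B a) → ∀ a → LazyPrefix (suc B) a
  extendLazyPrefix B ih a with a (suc B) in aTop | ih a
  ... | false | c , lc , c0 , cS , cW =
    c , lc , c0 , vanishes-suc cS ,
    trans (weight-false c B (cS _ (n<1+n B))) (trans cW (sym (weight-false a B aTop)))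
  ... | true | c , lc , c0 , cS , cW with raiseOrBlock c B lc
  ...   | inj₁ raisedLazy =
    raise c B , raisedLazy , trans (raise-below c {B} z≤n) c0 , raise-vanishes cS ,
    raisePrefixWeight c B cW aTop
  ...   | inj₂ (j0 , refl , zeros) with ih (move (raise c (j0 + N)) (suc j0))
  ...     | f , lf , f0 , fS , fW =
    f , lf , f0 , vanishes-suc fS ,
    trans (afterMove j0 (raise-top c (j0 + N)) zeros fS fW) (raisePrefixWeight c (j0 + N) cW aTop)

  lazyPrefix : ∀ B a → LazyPrefix B a
  lazyPrefix zero    a = (λ _ → false) , (λ { _ _ (_ , _ , ()) _ }) , refl , (λ _ _ → refl) , refl
  lazyPrefix (suc B) = extendLazyPrefix B (lazyPrefix B)

  lazyRepresentative : ∀ {n c} → InS A n c → ∃ λ z → Lazy z × InS A n z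
  lazyRepresentative {c = c} (c0 , B , cS , cW) with lazyPrefix B c
  ... | z , lz , z0 , zS , zW = z , lz , z0 , B , zS , trans zW cW

  lazyHasNoEdge : ∀ {a b} → Lazy a → ¬ Edge N a b
  lazyHasNoEdge la (j , 1≤j , top , zeros , _) = la j 1≤j (j + N , m∸n≤m (j + N) 1 , top) zeros

  lazyMinimal : ∀ {n z} → InS A n z → Lazy z → Minimal N A n z
  lazyMinimal zIn lz = zIn , λ { b _ ε → λ _ → refl ; b _ (e ◅ _) → ⊥-elim (lazyHasNoEdge lz e) }

  -- A non-lazy sequence admits an edge move: the first 1 after its zero block
  -- has N zeros right below it.
  findMove : ∀ {b} j → 1 ≤ j → (∃ λ m → j + N ∸ 1 ≤ m × b m ≡ true) → Block b j N false →
    ∃ λ j′ → 1 ≤ j′ × b (j′ + N) ≡ true × Block b j′ N false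
  findMove {b} j 1≤j (m , m≥ , bm) zeros
    with firstOne b j (m ∸ j) (subst (λ x → b x ≡ true) (sym (m+[n∸m]≡n (start≤ {j} m≥))) bm)
  ... | m′ , j≤m′ , bm′ , before =
    m′ ∸ N , ≤-trans 1≤j j≤j′ , subst (λ x → b x ≡ true) (sym j′+N≡m′) bm′ , zeros′
    where
    end≤m′ : j + N ≤ m′
    end≤m′ = pastZeroBlock {b} zeros bm′ j≤m′

    j′+N≡m′ : m′ ∸ N + N ≡ m′
    j′+N≡m′ = m∸n+n≡m (≤-trans (m≤n+m N j) end≤m′)

    j≤j′ : j ≤ m′ ∸ N
    j≤j′ = m+n≤o⇒m≤o∸n j end≤m′

    zeros′ : Block b (m′ ∸ N) N false
    zeros′ i i<N = before (m′ ∸ N + i) (≤-trans j≤j′ (m≤m+n _ i))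
      (subst (m′ ∸ N + i <_) j′+N≡m′ (+-monoʳ-< (m′ ∸ N) i<N))

  moveInS : ∀ {n b j} → InS A n b → 1 ≤ j → b (j + N) ≡ true → Block b j N false →
    InS A n (move b j)
  moveInS {n} {b} {j} (b0 , B , bS , bW) 1≤j top zeros =
    trans (move-outside b j 0 (inj₁ 1≤j)) b0 , B ,
    (λ t B<t → trans (move-outside b j t (inj₂ (≤-<-trans end≤B B<t))) (bS t B<t)) ,
    trans (sym (edgeWeight (moveEdge b j 1≤j top zeros) end≤B)) bW
    where
    end≤B : j + N ≤ B
    end≤B = withinSupport bS top

  -- A minimal element is lazy: otherwise its edge move would be a smaller element.
  minimalIsLazy : ∀ {n b} → Minimal N A n b → Lazy b
  minimalIsLazy {n} {b} (bIn , minimal) j 1≤j later zeros with findMove j 1≤j later zeros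
  ... | j′ , 1≤j′ , top , zeros′ = true≢false (begin
    true              ≡⟨ sym top ⟩
    b (j′ + N)        ≡⟨ minimal (move b j′) (moveInS bIn 1≤j′ top zeros′)
                                 (moveEdge b j′ 1≤j′ top zeros′ ◅ ε) (j′ + N) ⟩
    move b j′ (j′ + N) ≡⟨ move-top b j′ ⟩
    false             ∎)
    where open ≡-Reasoning

proposition3p3 : (N : ℕ) → 2 ≤ N → (A : ℕ → ℕ) → Quasifibonacci N A →
    (n : ℕ) → 1 ≤ n → ∃ (λ (c : ℕ → Bool) → InS A n c) →
    ∃ λ (z : ℕ → Bool) →
      Minimal N A n z ×
      (∀ b → Minimal N A n b → b ≗ z) ×
      NoNZeros N z ×
      (∀ b → InS A n b → NoNZeros N b → b ≗ z)
proposition3p3 N N≥2 A q n _ (c , cIn) =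
  z , lazyMinimal zIn zLazy ,
  (λ b bMinimal → lazyUnique (minimalIsLazy bMinimal) zLazy (proj₁ bMinimal) zIn) ,
  zLazy ,
  (λ b bIn bLazy → lazyUnique bLazy zLazy bIn zIn)
  where
  open LazyRepresentations N (<⇒≤ N≥2) A q

  representative : ∃ λ z → Lazy z × InS A n z
  representative = lazyRepresentative cIn

  z : ℕ → Bool
  z = proj₁ representative

  zLazy : Lazy z
  zLazy = proj₁ (proj₂ representative)

  zIn : InS A n z
  zIn = proj₂ (proj₂ representative)
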